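{- Let $\Pi\subseteq\mathfrak S_n$ form an allowable graph of permutations with set of moves $\mathcal M$. Then two distinct permutations $\sigma,\sigma'\in\Pi$ differ by a move in $\mathcal M$ (i.e. form an edge of the allowable graph) if and only if there is no $\sigma''\in\Pi\setminus\{\sigma\}$ with $\mathrm{inv}(\sigma)\triangle\mathrm{inv}(\sigma'')\subsetneq\mathrm{inv}(\sigma)\triangle\mathrm{inv}(\sigma')$. In particular the graph depends only on $\Pi$ and not on $\mathcal M$.
   Context: Permutations $\sigma\in\mathfrak S_n$ are words $[\sigma(1),\dots,\sigma(n)]$; $\mathrm{inv}(\sigma)$ is the set of pairs of letters $(i,j)$, $i<j$, such that $j$ appears before $i$ in $\sigma$; $\triangle$ is symmetric difference. A move is a set of one or more pairwise disjoint contiguous substrings (length $\ge2$), applied to $\sigma$ by reversing each, giving $\gamma$; its inversion set is $\mathrm{Inv}_m=\mathrm{inv}(\sigma)\triangle\mathrm{inv}(\gamma)$ (the pairs of letters in a common substring of $m$). An allowable sequence in $\Pi$ from $\sigma$ to $\sigma'$ is a sequence $\sigma=\sigma_0,\dots,\sigma_l=\sigma'$ in $\Pi$ with each $\sigma_k$ obtained from $\sigma_{k-1}$ by a move $m_k$ and the $\mathrm{Inv}_{m_k}$ pairwise disjoint. $\bar\sigma(t)=\sigma(n-t+1)$. $\Pi$ forms an allowable graph of permutations with set of moves $\mathcal M$ if (P1) $\Pi$ is closed under $\sigma\mapsto\bar\sigma$; (P2) any two elements of $\Pi$ are joined by an allowable sequence in $\Pi$ with moves in $\mathcal M$; (P3)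 for $m,s\in\mathcal M$, $\mathrm{Inv}_m=\mathrm{Inv}_s$ or $\mathrm{Inv}_m\cap\mathrm{Inv}_s=\emptyset$. The allowable graph has vertex set $\Pi$ and edges the pairs of permutations of $\Pi$ differing by a move in $\mathcal M$. -}

module Defs where

open import Level using (0ℓ)
open import Data.Nat using (ℕ; _≥_)
open import Data.Fin using (Fin; _<_)
open import Data.Empty using (⊥)
open import Data.List using (List; allFin; []; _∷_; _++_; [_]; reverse; length)
open import Data.List.Membership.Propositional using (_∈_)
open import Data.List.Relation.Binary.Permutation.Propositional using (_↭_)
open import Data.List.Relation.Unary.All using (All)
open import Data.List.Relation.Unary.AllPairs using (AllPairs)
open import Data.Product using (_×_; ∃; ∃₂; Σ; _,_)
open import Data.Sum using (_⊎_)
open import Relation.Nullary using (¬_)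
open import Relation.Binary.PropositionalEquality using (_≡_)
open import Relation.Unary using (Pred; _∪_; _∖_)

Word : ℕ → Set
Word n = List (Fin n)

-- σ ∈ 𝔖_n : the word [σ(1),…,σ(n)] is a rearrangement of all letters.
IsPerm : ∀ {n} → Word n → Set
IsPerm {n} w = w ↭ allFin n

Before : ∀ {n} → Word n → Fin n → Fin n → Set
Before w a b = ∃₂ λ xs ys → (w ≡ xs ++ [ a ] ++ ys) × (b ∈ ys)

inv : ∀ {n} → Word n → Pred (Fin n × Fin n) 0ℓ
inv w (i , j) = (i < j) × Before w j i

_△_ : ∀ {n} → Pred (Fin n × Fin n) 0ℓ → Pred (Fin n × Fin n) 0ℓ → Pred (Fin n × Fin n) 0ℓ
A △ B = (A ∖ B) ∪ (B ∖ A)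

bar : ∀ {n} → Word n → Word n
bar = reverse

-- A move: a (nonempty) set of substrings, listed left to right as words of letters,
-- each of length ≥ 2.  Disjointness is enforced by how a move is applied (Apply).
Move : ℕ → Set
Move n = List (Word n)

IsMove : ∀ {n} → Move n → Set
IsMove m = (¬ (m ≡ [])) × All (λ s → length s ≥ 2) m

-- Apply m σ γ : γ is obtained from σ by reversing the substrings of m, which occur
-- in σ as pairwise disjoint contiguous substrings, in the listed left-to-right order.
data Apply {n} : Move n → Word n → Word n → Set where
  done : ∀ {xs} → Apply [] xs xs
  skip : ∀ {m x xs ys} → Apply m xs ys → Apply m (x ∷ xs) (x ∷ ys)
  rev  : ∀ {m s xs ys} → Apply m xs ys → Apply (s ∷ m) (s ++ xs) (reverse s ++ ys)

Inv : ∀ {n} → Move n → Pred (Fin n × Fin n) 0ℓ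
Inv m (i , j) = (i < j) × ∃ λ s → (s ∈ m) × (i ∈ s) × (j ∈ s)

DisjointInv : ∀ {n} → Move n → Move n → Set
DisjointInv m s = ∀ p → Inv m p → Inv s p → ⊥

SameInv : ∀ {n} → Move n → Move n → Set
SameInv m s = ∀ p → (Inv m p → Inv s p) × (Inv s p → Inv m p)

data Seq {n} (Π : Pred (Word n) 0ℓ) (𝓜 : Pred (Move n) 0ℓ) : Word n → List (Move n) → Word n → Set where
  nil  : ∀ {σ} → Seq Π 𝓜 σ [] σ
  cons : ∀ {σ τ σ' m ms} → 𝓜 m → Apply m σ τ → Π τ → Seq Π 𝓜 τ ms σ' → Seq Π 𝓜 σ (m ∷ ms) σ'

AllowableSeq : ∀ {n} → Pred (Word n) 0ℓ → Pred (Move n) 0ℓ → Word n → Word n → Set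
AllowableSeq Π 𝓜 σ σ' =
  Π σ × ∃ λ ms → Seq Π 𝓜 σ ms σ' × AllPairs DisjointInv ms

record AllowableGraph (n : ℕ) (Π : Pred (Word n) 0ℓ) (𝓜 : Pred (Move n) 0ℓ) : Set where
  field
    perms  : ∀ σ → Π σ → IsPerm σ
    moves  : ∀ m → 𝓜 m → IsMove m
    P1     : ∀ σ → Π σ → Π (bar σ)
    P2     : ∀ σ σ' → Π σ → Π σ' → AllowableSeq Π 𝓜 σ σ'
    P3     : ∀ m s → 𝓜 m → 𝓜 s → SameInv m s ⊎ DisjointInv m s

Edge : ∀ {n} → Pred (Word n) 0ℓ → Pred (Move n) 0ℓ → Word n → Word n → Set
Edge Π 𝓜 σ σ' =
  Π σ × Π σ' × ∃ λ m → 𝓜 m × (Apply m σ σ' ⊎ Apply m σ' σ)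

{-# OPTIONS --safe #-}
-- Applying a move m to σ changes the relative order of two letters exactly when they lie in a
-- common block of m, so inv σ △ inv τ = Inv_m.  Along an allowable sequence the sets Inv_{m_k}
-- are disjoint, hence each of them survives into inv σ △ inv σ'.  If σ σ' is an edge by m and
-- σ'' is joined to σ by a sequence starting with m₁, then Inv_{m₁} ⊆ inv σ △ inv σ'' and, by (P3),
-- Inv_{m₁} is Inv_m or disjoint from it; either way inv σ △ inv σ'' ⊂ Inv_m is impossible.
-- Conversely, if the sequence from σ to σ' has at least two moves, its second permutation σ₁
-- satisfies inv σ △ inv σ₁ = Inv_{m₁} ⊂ inv σ △ inv σ', the inclusion being strict because of
-- the nonempty Inv_{m₂}.
module Submission where

open import Defs
open import Level using (0ℓ)
open import Data.Nat using (ℕ; s≤s)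
open import Data.Product using (_×_; ∃; _,_; proj₁; proj₂)
import Data.Product as Product
open import Data.Sum using (_⊎_; inj₁; inj₂)
import Data.Sum as Sum
open import Data.Empty using (⊥-elim)
open import Data.Fin using (Fin; _≟_)
open import Data.Fin.Properties using (<-irrefl; <-cmp)
open import Data.List using (List; []; _∷_; _++_; reverse; map)
open import Data.List.Properties using (unfold-reverse; reverse-involutive)
open import Data.List.Membership.Propositional using (_∈_)
open import Data.List.Membership.Propositional.Properties using (∈-++⁺ˡ; ∈-++⁺ʳ; ∈-++⁻; ∈-map⁺; ∈-map⁻)
import Data.List.Membership.DecPropositional as DecMembership
open import Data.List.Relation.Unary.Any using (here; there)
open import Data.List.Relation.Unary.Any.Properties using (reverse⁺; reverse⁻)
open import Data.List.Relation.Unary.All using (All; []; _∷_; lookup)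
import Data.List.Relation.Unary.All as All
open import Data.List.Relation.Unary.All.Properties using (++⁻ˡ; ++⁻ʳ)
open import Data.List.Relation.Unary.AllPairs using (AllPairs; []; _∷_)
import Data.List.Relation.Unary.AllPairs as AllPairs
open import Data.List.Relation.Unary.Unique.Propositional using (Unique)
open import Data.List.Relation.Unary.Unique.Propositional.Properties using (allFin⁺)
open import Data.List.Relation.Binary.Disjoint.Propositional using (Disjoint)
open import Data.List.Relation.Binary.Permutation.Propositional using (↭⇒↭ₛ; ↭-sym)
open import Data.List.Relation.Binary.Permutation.Setoid.Properties using (Unique-resp-↭)
open import Relation.Nullary using (¬_; Dec; yes; no)
open import Relation.Nullary.Decidable using (_×-dec_)
open import Relation.Binary.Definitions using (tri<; tri≈; tri>)
open import Relation.Binary.PropositionalEquality using (_≡_; refl; sym; subst; setoid)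
open import Relation.Unary using (Pred; Satisfiable; _⊂_; _⊆_)
open import Function.Bundles using (_⇔_; mk⇔; Equivalence)
open import Function.Construct.Identity using (⇔-id)
open import Function.Construct.Composition using (_⇔-∘_)
open import Function.Construct.Symmetry using (⇔-sym)
open import Function using (_∘_)

module _ {n : ℕ} where

  private variable
    a b c : Fin n
    m : Move n
    w xs ys s σ τ : Word n

  open DecMembership (_≟_ {n}) using (_∈?_)

  data Precedes : Word n → Fin n → Fin n → Set where
    at-head : ∀ {a b xs} → b ∈ xs → Precedes (a ∷ xs) a b
    in-tail : ∀ {x a b xs} → Precedes xs a b → Precedes (x ∷ xs) a b

  Before⇒Precedes : Before w a b → Precedes w a b
  Before⇒Precedes ([] , ys , refl , b∈ys) = at-head b∈ys
  Before⇒Precedes (x ∷ xs , ys , refl , b∈ys) = in-tail (Before⇒Precedes (xs , ys , refl , b∈ys))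

  Precedes⇒Before : Precedes w a b → Before w a b
  Precedes⇒Before (at-head {xs = xs} b∈xs) = [] , xs , refl , b∈xs
  Precedes⇒Before (in-tail {x = x} p) with Precedes⇒Before p
  ... | xs , ys , refl , b∈ys = x ∷ xs , ys , refl , b∈ys

  Precedes-∈ : Precedes w a b → a ∈ w × b ∈ w
  Precedes-∈ (at-head b∈xs) = here refl , there b∈xs
  Precedes-∈ (in-tail p) = Product.map there there (Precedes-∈ p)

  Precedes-++⁺ˡ : Precedes xs a b → Precedes (xs ++ ys) a b
  Precedes-++⁺ˡ (at-head b∈xs) = at-head (∈-++⁺ˡ b∈xs)
  Precedes-++⁺ˡ (in-tail p) = in-tail (Precedes-++⁺ˡ p)

  Precedes-++⁺ : a ∈ xs → b ∈ ys → Precedes (xs ++ ys) a b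
  Precedes-++⁺ {xs = _ ∷ xs} (here refl) b∈ys = at-head (∈-++⁺ʳ xs b∈ys)
  Precedes-++⁺ {xs = _ ∷ xs} (there a∈xs) b∈ys = in-tail (Precedes-++⁺ a∈xs b∈ys)

  Precedes-++⁺ʳ : ∀ xs → Precedes ys a b → Precedes (xs ++ ys) a b
  Precedes-++⁺ʳ [] p = p
  Precedes-++⁺ʳ (x ∷ xs) p = in-tail (Precedes-++⁺ʳ xs p)

  Precedes-++⁻ : ∀ xs → Precedes (xs ++ ys) a b →
                 Precedes xs a b ⊎ (a ∈ xs × b ∈ ys) ⊎ Precedes ys a b
  Precedes-++⁻ [] p = inj₂ (inj₂ p)
  Precedes-++⁻ (x ∷ xs) (at-head b∈) with ∈-++⁻ xs b∈
  ... | inj₁ b∈xs = inj₁ (at-head b∈xs)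
  ... | inj₂ b∈ys = inj₂ (inj₁ (here refl , b∈ys))
  Precedes-++⁻ (x ∷ xs) (in-tail p) with Precedes-++⁻ xs p
  ... | inj₁ q = inj₁ (in-tail q)
  ... | inj₂ (inj₁ (a∈xs , b∈ys)) = inj₂ (inj₁ (there a∈xs , b∈ys))
  ... | inj₂ (inj₂ q) = inj₂ (inj₂ q)

  Precedes-reverse⁻ : ∀ s → Precedes (reverse s) a b → Precedes s b a
  Precedes-reverse⁻ (x ∷ s) p
    with Precedes-++⁻ (reverse s) (subst (λ w → Precedes w _ _) (unfold-reverse x s) p)
  ... | inj₁ q = in-tail (Precedes-reverse⁻ s q)
  ... | inj₂ (inj₁ (a∈ , here refl)) = at-head (reverse⁻ a∈)
  ... | inj₂ (inj₂ (in-tail ()))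

  Precedes-asym : Unique w → Precedes w a b → ¬ Precedes w b a
  Precedes-asym (x∉ ∷ _) (at-head b∈) (at-head _) = lookup x∉ b∈ refl
  Precedes-asym (x∉ ∷ _) (at-head _) (in-tail q) = lookup x∉ (proj₂ (Precedes-∈ q)) refl
  Precedes-asym (x∉ ∷ _) (in-tail p) (at-head _) = lookup x∉ (proj₂ (Precedes-∈ p)) refl
  Precedes-asym (_ ∷ u) (in-tail p) (in-tail q) = Precedes-asym u p q

  Precedes-total : a ∈ w → b ∈ w → ¬ a ≡ b → Precedes w a b ⊎ Precedes w b a
  Precedes-total (here refl) (here refl) a≢b = ⊥-elim (a≢b refl)
  Precedes-total (here refl) (there b∈) _ = inj₁ (at-head b∈)
  Precedes-total (there a∈) (here refl) _ = inj₂ (at-head a∈)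
  Precedes-total (there a∈) (there b∈) a≢b = Sum.map in-tail in-tail (Precedes-total a∈ b∈ a≢b)

  Unique-++⁻ : ∀ xs → Unique (xs ++ ys) → Unique xs × Unique ys × Disjoint xs ys
  Unique-++⁻ [] u = [] , u , λ ()
  Unique-++⁻ (x ∷ xs) (x∉ ∷ u) with Unique-++⁻ xs u
  ... | uxs , uys , xs#ys = ++⁻ˡ xs x∉ ∷ uxs , uys ,
        λ { (here refl , x∈ys) → lookup (++⁻ʳ xs x∉) x∈ys refl
          ; (there c∈xs , c∈ys) → xs#ys (c∈xs , c∈ys) }

  IsPerm⇒Unique : IsPerm w → Unique w
  IsPerm⇒Unique w↭ = Unique-resp-↭ (setoid (Fin n)) (↭⇒↭ₛ (↭-sym w↭)) (allFin⁺ n)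

  Apply-∈⁻ : Apply m xs ys → c ∈ ys → c ∈ xs
  Apply-∈⁻ done c∈ = c∈
  Apply-∈⁻ (skip ap) (here refl) = here refl
  Apply-∈⁻ (skip ap) (there c∈) = there (Apply-∈⁻ ap c∈)
  Apply-∈⁻ (rev {s = s} ap) c∈ with ∈-++⁻ (reverse s) c∈
  ... | inj₁ c∈s = ∈-++⁺ˡ (reverse⁻ {xs = s} c∈s)
  ... | inj₂ c∈ys = ∈-++⁺ʳ s (Apply-∈⁻ ap c∈ys)

  Apply-block-∈ : Apply m xs ys → s ∈ m → c ∈ s → c ∈ xs
  Apply-block-∈ (skip ap) s∈m c∈s = there (Apply-block-∈ ap s∈m c∈s)
  Apply-block-∈ (rev ap) (here refl) c∈s = ∈-++⁺ˡ c∈s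
  Apply-block-∈ (rev {s = s} ap) (there s∈m) c∈s = ∈-++⁺ʳ s (Apply-block-∈ ap s∈m c∈s)

  Apply-block-Unique : Apply m xs ys → Unique xs → s ∈ m → Unique s
  Apply-block-Unique (skip ap) (_ ∷ u) s∈m = Apply-block-Unique ap u s∈m
  Apply-block-Unique (rev {s = s} ap) u (here refl) = proj₁ (Unique-++⁻ s u)
  Apply-block-Unique (rev {s = s} ap) u (there s∈m) =
    Apply-block-Unique ap (proj₁ (proj₂ (Unique-++⁻ s u))) s∈m

  Apply-inverse : Apply m xs ys → Apply (map reverse m) ys xs
  Apply-inverse done = done
  Apply-inverse (skip ap) = skip (Apply-inverse ap)
  Apply-inverse (rev {m = m} {s = s} {xs = xs} {ys = ys} ap) =
    subst (λ r → Apply (reverse s ∷ map reverse m) (reverse s ++ ys) (r ++ xs))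
          (reverse-involutive s) (rev (Apply-inverse ap))

  SameBlock : Move n → Fin n → Fin n → Set
  SameBlock m a b = ∃ λ s → s ∈ m × a ∈ s × b ∈ s

  SameBlock-sym : SameBlock m a b → SameBlock m b a
  SameBlock-sym (s , s∈m , a∈s , b∈s) = s , s∈m , b∈s , a∈s

  SameBlock-map-reverse : SameBlock m a b ⇔ SameBlock (map reverse m) a b
  SameBlock-map-reverse = mk⇔
    (λ (s , s∈m , a∈s , b∈s) → reverse s , ∈-map⁺ reverse s∈m , reverse⁺ a∈s , reverse⁺ b∈s)
    (λ (r , r∈ , a∈r , b∈r) → let (s , s∈m , r≡) = ∈-map⁻ reverse r∈ in
       s , s∈m , reverse⁻ (subst (_ ∈_) r≡ a∈r) , reverse⁻ (subst (_ ∈_) r≡ b∈r))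

  SameBlock? : ∀ m a b → Dec (SameBlock m a b)
  SameBlock? [] a b = no λ ()
  SameBlock? (s ∷ m) a b with (a ∈? s) ×-dec (b ∈? s) | SameBlock? m a b
  ... | yes (a∈s , b∈s) | _ = yes (s , here refl , a∈s , b∈s)
  ... | no _ | yes (s' , s'∈m , a∈ , b∈) = yes (s' , there s'∈m , a∈ , b∈)
  ... | no ¬ab∈s | no ¬same = no λ
    { (_ , here refl , a∈s , b∈s) → ¬ab∈s (a∈s , b∈s)
    ; (s' , there s'∈m , a∈ , b∈) → ¬same (s' , s'∈m , a∈ , b∈) }

  ReversesBlocks : Move n → Word n → Word n → Set
  ReversesBlocks m σ τ = ∀ {a b} → Precedes σ a b →
    (SameBlock m a b → Precedes τ b a) × (¬ SameBlock m a b → Precedes τ a b)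

  Apply⇒ReversesBlocks⁻¹ : Unique σ → Apply m σ τ → ReversesBlocks m τ σ
  Apply⇒ReversesBlocks⁻¹ u done p = (λ ()) , λ _ → p
  Apply⇒ReversesBlocks⁻¹ (x∉ ∷ _) (skip ap) (at-head b∈) =
    (λ (_ , s∈m , x∈s , _) → ⊥-elim (lookup x∉ (Apply-block-∈ ap s∈m x∈s) refl)) ,
    (λ _ → at-head (Apply-∈⁻ ap b∈))
  Apply⇒ReversesBlocks⁻¹ (_ ∷ u) (skip ap) (in-tail p) =
    Product.map (in-tail ∘_) (in-tail ∘_) (Apply⇒ReversesBlocks⁻¹ u ap p)
  Apply⇒ReversesBlocks⁻¹ u (rev {s = s} ap) p
    with Unique-++⁻ s u | Precedes-++⁻ (reverse s) p
  ... | _ , _ , s#xs | inj₁ q =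
    (λ _ → Precedes-++⁺ˡ (Precedes-reverse⁻ s q)) ,
    (λ ¬same → let (b∈s , a∈s) = Precedes-∈ (Precedes-reverse⁻ s q)
               in ⊥-elim (¬same (s , here refl , a∈s , b∈s)))
  ... | _ , _ , s#xs | inj₂ (inj₁ (a∈ , b∈)) =
    (λ { (_ , here refl , _ , b∈s) → ⊥-elim (s#xs (b∈s , Apply-∈⁻ ap b∈))
       ; (_ , there s'∈m , a∈s' , _) → ⊥-elim (s#xs (reverse⁻ a∈ , Apply-block-∈ ap s'∈m a∈s')) }) ,
    (λ _ → Precedes-++⁺ (reverse⁻ a∈) (Apply-∈⁻ ap b∈))
  ... | _ , uxs , s#xs | inj₂ (inj₂ q) =
    let (reversed , kept) = Apply⇒ReversesBlocks⁻¹ uxs ap q in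
    (λ { (_ , here refl , a∈s , _) → ⊥-elim (s#xs (a∈s , Apply-∈⁻ ap (proj₁ (Precedes-∈ q))))
       ; (s' , there s'∈m , in-s') → Precedes-++⁺ʳ s (reversed (s' , s'∈m , in-s')) }) ,
    (λ ¬same → Precedes-++⁺ʳ s (kept λ (s' , s'∈m , in-s') → ¬same (s' , there s'∈m , in-s')))

  Apply⇒ReversesBlocks : Unique τ → Apply m σ τ → ReversesBlocks m σ τ
  Apply⇒ReversesBlocks u ap p =
    let (reversed , kept) = Apply⇒ReversesBlocks⁻¹ u (Apply-inverse ap) p in
    (λ same → reversed (Equivalence.to SameBlock-map-reverse same)) ,
    (λ ¬same → kept (λ same → ¬same (Equivalence.from SameBlock-map-reverse same)))

  Inv⊆inv-△ : Unique σ → Unique τ → Apply m σ τ → Inv m ⊆ (inv σ △ inv τ)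
  Inv⊆inv-△ {σ = σ} {τ} uσ uτ ap {i , j} (i<j , same@(s , s∈m , i∈s , j∈s)) = Sum.[ reversed , kept ]′
    (Precedes-total (Apply-block-∈ ap s∈m j∈s) (Apply-block-∈ ap s∈m i∈s) (λ j≡i → <-irrefl (sym j≡i) i<j))
    where
    reversed : Precedes σ j i → (inv σ △ inv τ) (i , j)
    reversed j≺i = inj₁ ((i<j , Precedes⇒Before j≺i) ,
      λ (_ , j≺′i) → Precedes-asym uσ j≺i
                       (proj₁ (Apply⇒ReversesBlocks⁻¹ uσ ap (Before⇒Precedes j≺′i)) (SameBlock-sym same)))
    kept : Precedes σ i j → (inv σ △ inv τ) (i , j)
    kept i≺j = inj₂ ((i<j , Precedes⇒Before (proj₁ (Apply⇒ReversesBlocks uτ ap i≺j) same)) ,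
      λ (_ , j≺i) → Precedes-asym uσ i≺j (Before⇒Precedes j≺i))

  inv-stable : ∀ {p} → Unique σ → Unique τ → Apply m σ τ → ¬ Inv m p → inv σ p ⇔ inv τ p
  inv-stable uσ uτ ap ¬inv = mk⇔
    (λ (i<j , j≺i) → i<j , Precedes⇒Before
       (proj₂ (Apply⇒ReversesBlocks uτ ap (Before⇒Precedes j≺i)) λ same → ¬inv (i<j , SameBlock-sym same)))
    (λ (i<j , j≺i) → i<j , Precedes⇒Before
       (proj₂ (Apply⇒ReversesBlocks⁻¹ uσ ap (Before⇒Precedes j≺i)) λ same → ¬inv (i<j , SameBlock-sym same)))

  inv-△⊆Inv : Unique σ → Unique τ → Apply m σ τ → (inv σ △ inv τ) ⊆ Inv m
  inv-△⊆Inv {σ = σ} {τ = τ} {m = m} uσ uτ ap {i , j} d with SameBlock? m i j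
  ... | yes same = Sum.[ (λ ((i<j , _) , _) → i<j) , (λ ((i<j , _) , _) → i<j) ] d , same
  ... | no ¬same = ⊥-elim (Sum.[ (λ (x , ¬y) → ¬y (Equivalence.to stable x))
                               , (λ (y , ¬x) → ¬x (Equivalence.from stable y)) ] d)
    where
    stable : inv σ (i , j) ⇔ inv τ (i , j)
    stable = inv-stable uσ uτ ap λ (_ , same) → ¬same same

  SameBlock⇒Inv : ¬ a ≡ b → SameBlock m a b → Satisfiable (Inv m)
  SameBlock⇒Inv {a = a} {b} a≢b same with <-cmp a b
  ... | tri< a<b _ _ = (a , b) , a<b , same
  ... | tri≈ _ a≡b _ = ⊥-elim (a≢b a≡b)
  ... | tri> _ _ b<a = (b , a) , b<a , SameBlock-sym same

  Inv-satisfiable : IsMove m → Unique σ → Apply m σ τ → Satisfiable (Inv m)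
  Inv-satisfiable {m = []} (m≢[] , _) _ _ = ⊥-elim (m≢[] refl)
  Inv-satisfiable {m = (_ ∷ []) ∷ _} (_ , s≤s () ∷ _) _ _
  Inv-satisfiable {m = (a ∷ b ∷ s) ∷ _} _ u ap =
    SameBlock⇒Inv (lookup a∉ (here refl)) (_ , here refl , here refl , there (here refl))
    where
    a∉ : All (λ c → ¬ a ≡ c) (b ∷ s)
    a∉ = AllPairs.head (Apply-block-Unique ap u (here refl))

  △-congʳ : ∀ {A B C : Pred (Fin n × Fin n) 0ℓ} {p} → B p ⇔ C p → (A △ B) p → (A △ C) p
  △-congʳ B⇔C (inj₁ (a , ¬b)) = inj₁ (a , λ c → ¬b (Equivalence.from B⇔C c))
  △-congʳ B⇔C (inj₂ (b , ¬a)) = inj₂ (Equivalence.to B⇔C b , ¬a)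

  △-congˡ : ∀ {A B C : Pred (Fin n × Fin n) 0ℓ} {p} → A p ⇔ B p → (A △ C) p → (B △ C) p
  △-congˡ A⇔B (inj₁ (a , ¬c)) = inj₁ (Equivalence.to A⇔B a , ¬c)
  △-congˡ A⇔B (inj₂ (c , ¬a)) = inj₂ (c , λ b → ¬a (Equivalence.from A⇔B b))

  △-comm : ∀ {A B : Pred (Fin n × Fin n) 0ℓ} {p} → (A △ B) p → (B △ A) p
  △-comm (inj₁ x) = inj₂ x
  △-comm (inj₂ x) = inj₁ x

  △-irrefl : ∀ {A : Pred (Fin n × Fin n) 0ℓ} {p} → ¬ (A △ A) p
  △-irrefl (inj₁ (a , ¬a)) = ¬a a
  △-irrefl (inj₂ (a , ¬a)) = ¬a a

module _ {n : ℕ} {Π : Pred (Word n) 0ℓ} {𝓜 : Pred (Move n) 0ℓ}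
         (Π-unique : ∀ {w} → Π w → Unique w) where

  inv-stable-along : ∀ {τ ms σ p} → Π τ → Seq Π 𝓜 τ ms σ → All (λ m → ¬ Inv m p) ms →
                     inv τ p ⇔ inv σ p
  inv-stable-along _ nil [] = ⇔-id _
  inv-stable-along πτ (cons _ ap πτ₁ seq) (¬inv ∷ ¬invs) =
    inv-stable-along πτ₁ seq ¬invs ⇔-∘ inv-stable (Π-unique πτ) (Π-unique πτ₁) ap ¬inv

  Inv⊆inv-△-along : ∀ {σ ms σ'} → Π σ → Seq Π 𝓜 σ ms σ' → AllPairs DisjointInv ms →
                    All (λ m → Inv m ⊆ (inv σ △ inv σ')) ms
  Inv⊆inv-△-along _ nil [] = []
  Inv⊆inv-△-along {σ} {σ' = σ'} πσ (cons {τ = σ₁} {m = m₁} _ ap πσ₁ seq) (disjoint ∷ disjoints) =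
    first ∷ All.zipWith later (disjoint , Inv⊆inv-△-along πσ₁ seq disjoints)
    where
    first : Inv m₁ ⊆ (inv σ △ inv σ')
    first {p} p∈ = △-congʳ {A = inv σ} {inv σ₁} {inv σ'}
      (inv-stable-along πσ₁ seq (All.map (λ d → d p p∈) disjoint))
      (Inv⊆inv-△ (Π-unique πσ) (Π-unique πσ₁) ap p∈)
    later : ∀ {m} → DisjointInv m₁ m × Inv m ⊆ (inv σ₁ △ inv σ') → Inv m ⊆ (inv σ △ inv σ')
    later (d , Inv⊆gap) {p} p∈ = △-congˡ {A = inv σ₁} {inv σ} {inv σ'}
      (⇔-sym (inv-stable (Π-unique πσ) (Π-unique πσ₁) ap λ p∈₁ → d p p∈₁ p∈))
      (Inv⊆gap p∈)

module _ {n : ℕ} {Π : Pred (Word n) 0ℓ} {𝓜 : Pred (Move n) 0ℓ} (G : AllowableGraph n Π 𝓜) where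
  open AllowableGraph G

  private
    variable
      m m₁ m₂ : Move n
      ms : List (Move n)
      σ σ' : Word n

    unique : ∀ {w} → Π w → Unique w
    unique {w} πw = IsPerm⇒Unique (perms w πw)

  NoCloser : Word n → Word n → Set
  NoCloser σ σ' = ¬ (∃ λ σ'' → Π σ'' × ¬ (σ'' ≡ σ) × ((inv σ △ inv σ'') ⊂ (inv σ △ inv σ')))

  gap-contains-move : Π σ → Π σ' → ¬ σ' ≡ σ →
                      ∃ λ m → 𝓜 m × Satisfiable (Inv m) × Inv m ⊆ (inv σ △ inv σ')
  gap-contains-move πσ πσ' σ'≢σ with P2 _ _ πσ πσ'
  ... | _ , [] , nil , _ = ⊥-elim (σ'≢σ refl)
  ... | _ , m ∷ _ , seq@(cons m∈𝓜 ap _ _) , disjoints =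
    m , m∈𝓜 , Inv-satisfiable (moves m m∈𝓜) (unique πσ) ap ,
    All.head (Inv⊆inv-△-along unique πσ seq disjoints)

  edge-inv-△⊆Inv : Π σ → Π σ' → Apply m σ σ' ⊎ Apply m σ' σ → (inv σ △ inv σ') ⊆ Inv m
  edge-inv-△⊆Inv πσ πσ' (inj₁ ap) = inv-△⊆Inv (unique πσ) (unique πσ') ap
  edge-inv-△⊆Inv {σ = σ} {σ'} πσ πσ' (inj₂ ap) d =
    inv-△⊆Inv (unique πσ') (unique πσ) ap (△-comm {A = inv σ} {inv σ'} d)

  second-closer : Π σ → Seq Π 𝓜 σ (m₁ ∷ m₂ ∷ ms) σ' → AllPairs DisjointInv (m₁ ∷ m₂ ∷ ms) →
                  ∃ λ σ₁ → Π σ₁ × ¬ σ₁ ≡ σ × ((inv σ △ inv σ₁) ⊂ (inv σ △ inv σ'))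
  second-closer {σ = σ} {m₁ = m₁} {m₂ = m₂} {σ' = σ'}
                πσ seq@(cons {τ = σ₁} m₁∈𝓜 ap₁ πσ₁ (cons m₂∈𝓜 ap₂ _ _)) disjoints@((m₁#m₂ ∷ _) ∷ _) =
    σ₁ , πσ₁ , σ₁≢σ , (λ d → Inv₁⊆gap (inv-△⊆Inv uσ uσ₁ ap₁ d)) , ¬farther
    where
    uσ : Unique σ
    uσ = unique πσ
    uσ₁ : Unique σ₁
    uσ₁ = unique πσ₁
    Inv₁⊆gap : Inv m₁ ⊆ (inv σ △ inv σ')
    Inv₁⊆gap = All.head (Inv⊆inv-△-along unique πσ seq disjoints)
    Inv₂⊆gap : Inv m₂ ⊆ (inv σ △ inv σ')
    Inv₂⊆gap = All.head (All.tail (Inv⊆inv-△-along unique πσ seq disjoints))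
    σ₁≢σ : ¬ σ₁ ≡ σ
    σ₁≢σ refl = let (p , p∈) = Inv-satisfiable (moves _ m₁∈𝓜) uσ ap₁ in
                △-irrefl {A = inv σ} (Inv⊆inv-△ uσ uσ₁ ap₁ p∈)
    ¬farther : ¬ (inv σ △ inv σ') ⊆ (inv σ △ inv σ₁)
    ¬farther farther = let (q , q∈) = Inv-satisfiable (moves _ m₂∈𝓜) uσ₁ ap₂ in
                       m₁#m₂ q (inv-△⊆Inv uσ uσ₁ ap₁ (farther (Inv₂⊆gap q∈))) q∈

  Edge⇒NoCloser : Edge Π 𝓜 σ σ' → NoCloser σ σ'
  Edge⇒NoCloser (πσ , πσ' , m , m∈𝓜 , apply) (_ , πσ'' , σ''≢σ , closer , ¬farther)
    with gap-contains-move πσ πσ'' σ''≢σ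
  ... | m₁ , m₁∈𝓜 , (p , p∈) , Inv₁⊆gap with P3 m₁ m m₁∈𝓜 m∈𝓜
  ...   | inj₁ same = ¬farther λ d → Inv₁⊆gap (proj₂ (same _) (edge-inv-△⊆Inv πσ πσ' apply d))
  ...   | inj₂ disjoint = disjoint p p∈ (edge-inv-△⊆Inv πσ πσ' apply (closer (Inv₁⊆gap p∈)))

  NoCloser⇒Edge : Π σ → Π σ' → ¬ σ ≡ σ' → NoCloser σ σ' → Edge Π 𝓜 σ σ'
  NoCloser⇒Edge πσ πσ' σ≢σ' noCloser with P2 _ _ πσ πσ'
  ... | _ , [] , nil , _ = ⊥-elim (σ≢σ' refl)
  ... | _ , m ∷ [] , cons m∈𝓜 ap _ nil , _ = πσ , πσ' , m , m∈𝓜 , inj₁ ap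
  ... | _ , _ ∷ _ ∷ _ , seq@(cons _ _ _ (cons _ _ _ _)) , disjoints =
    ⊥-elim (noCloser (second-closer πσ seq disjoints))

lemma7p6 : (n : ℕ) (Π : Pred (Word n) 0ℓ) (𝓜 : Pred (Move n) 0ℓ) →
    AllowableGraph n Π 𝓜 →
    (σ σ' : Word n) → Π σ → Π σ' → ¬ (σ ≡ σ') →
    Edge Π 𝓜 σ σ' ⇔
      (¬ (∃ λ σ'' → Π σ'' × ¬ (σ'' ≡ σ) × ((inv σ △ inv σ'') ⊂ (inv σ △ inv σ'))))
lemma7p6 n Π 𝓜 G σ σ' πσ πσ' σ≢σ' = mk⇔ (Edge⇒NoCloser G) (NoCloser⇒Edge G πσ πσ' σ≢σ')
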